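{- Let $\mathcal{A}\subseteq\mathbb{N}$ and let $G$ be a finite simple graph. Then $G$ is $\mathcal{A}$-reducible if and only if $G$ has an acyclic orientation in which one vertex is a sink (has out-degree zero) and the out-degree of every other vertex belongs to $\mathcal{A}$. In particular, if $0\in\mathcal{A}$, then $G$ is $\mathcal{A}$-reducible if and only if $G$ has an acyclic orientation in which the out-degree of every vertex belongs to $\mathcal{A}$.
   Context: Graphs are finite, simple and undirected. For $\mathcal{A}\subseteq\mathbb{N}=\{0,1,2,\dots\}$, a graph $G$ is called $\mathcal{A}$-reducible if either $G$ is the graph with exactly one vertex, or there is a vertex $v$ of $G$ whose degree in $G$ belongs to $\mathcal{A}$ and such that $G\setminus v$ (the graph obtained by deleting $v$ and its incident edges) is $\mathcal{A}$-reducible. An orientation of $G$ is a choice of direction for each edge; it is acyclic if the resulting directed graph has no directed cycle. -}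

module Defs where

open import Data.Nat using (ℕ; zero; suc; _+_)
open import Data.Bool using (Bool; true; false; if_then_else_)
open import Data.Fin using (Fin; zero; suc; punchIn)
open import Data.Empty using (⊥)
open import Data.Product using (_×_; Σ)
open import Data.Sum using (_⊎_)
open import Relation.Nullary using (¬_)
open import Relation.Binary.PropositionalEquality using (_≡_; _≢_)
open import Relation.Binary.Construct.Closure.Transitive using (TransClosure)

count : ∀ {n} → (Fin n → Bool) → ℕ
count {zero}  f = 0
count {suc n} f = (if f zero then 1 else 0) + count (λ i → f (suc i))

record Graph (n : ℕ) : Set where
  field
    adj    : Fin n → Fin n → Bool
    sym    : ∀ i j → adj i j ≡ adj j i
    irrefl : ∀ i → adj i i ≡ false
open Graph public

deg : ∀ {n} → Graph n → Fin n → ℕ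
deg G v = count (adj G v)

delete : ∀ {n} → Graph (suc n) → Fin (suc n) → Graph n
delete G v = record
  { adj    = λ i j → adj G (punchIn v i) (punchIn v j)
  ; sym    = λ i j → sym G (punchIn v i) (punchIn v j)
  ; irrefl = λ i → irrefl G (punchIn v i)
  }

data Reducible (A : ℕ → Set) : ∀ {n} → Graph n → Set where
  single : (G : Graph 1) → Reducible A G
  step   : ∀ {n} (G : Graph (suc n)) (v : Fin (suc n)) →
           A (deg G v) → Reducible A (delete G v) → Reducible A G

-- An orientation of G: every edge {i,j} gets exactly one direction,
-- and only edges get directions.  dir i j ≡ true means the arc i → j.
record Orientation {n} (G : Graph n) : Set where
  field
    dir      : Fin n → Fin n → Bool
    dir-edge : ∀ i j → dir i j ≡ true → adj G i j ≡ true
    edge-dir : ∀ i j → adj G i j ≡ true → dir i j ≡ true ⊎ dir j i ≡ true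
    antisym  : ∀ i j → dir i j ≡ true → dir j i ≡ false
open Orientation public

Arc : ∀ {n} {G : Graph n} → Orientation G → Fin n → Fin n → Set
Arc O i j = dir O i j ≡ true

Acyclic : ∀ {n} {G : Graph n} → Orientation G → Set
Acyclic {n} O = ∀ (i : Fin n) → ¬ TransClosure (Arc O) i i

outdeg : ∀ {n} {G : Graph n} → Orientation G → Fin n → ℕ
outdeg O v = count (dir O v)

-- Deleting the vertices of a reducible graph one by one and orienting every edge from the
-- endpoint deleted first to the one deleted later yields an acyclic orientation in which each
-- vertex has out-degree equal to its degree at the moment of deletion, and the last vertex is
-- a sink.  Conversely an acyclic orientation is a deletion order: the acyclic relation on the
-- vertices other than the sink s has a source u, which is then a source of the whole
-- orientation (s has no out-arcs), so its out-degree is its degree; delete u and recurse.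
-- When 0 ∈ 𝒜 the sink condition is free, because every acyclic orientation has a sink.
module Submission where

open import Defs hiding (sym)
open import Data.Nat using (ℕ; zero; suc; _+_)
open import Data.Nat.Properties using (+-comm; +-assoc)
open import Data.Bool using (Bool; true; false; if_then_else_; _∨_; _∧_)
open import Data.Bool.Properties using (∨-conicalˡ; ∨-conicalʳ)
open import Data.Fin using (Fin; zero; suc; punchIn; punchOut; _≟_)
open import Data.Fin.Properties using (punchIn-injective; punchInᵢ≢i; punchIn-punchOut)
open import Data.Empty using (⊥-elim)
open import Data.Product using (_×_; Σ; ∃; _,_)
open import Data.Sum using (_⊎_; inj₁; inj₂)
open import Function.Base using (flip; _∘_)
open import Function.Bundles using (_⇔_; mk⇔)
open import Relation.Nullary using (¬_; yes; no)
open import Relation.Binary.PropositionalEquality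
  using (_≡_; _≢_; refl; sym; trans; cong; cong₂; subst; module ≡-Reasoning)
open import Relation.Binary.Construct.Closure.Transitive using (TransClosure; [_]; _∷_; _∷ʳ_; _++_)

count-cong : ∀ {n} {f g : Fin n → Bool} → (∀ i → f i ≡ g i) → count f ≡ count g
count-cong {zero}  f≗g = refl
count-cong {suc n} f≗g = cong₂ _+_ (cong (λ b → if b then 1 else 0) (f≗g zero)) (count-cong (f≗g ∘ suc))

count-false : ∀ n → count {n} (λ _ → false) ≡ 0
count-false zero    = refl
count-false (suc n) = count-false n

count-punchIn : ∀ {n} (f : Fin (suc n) → Bool) (v : Fin (suc n)) →
                count f ≡ (if f v then 1 else 0) + count (f ∘ punchIn v)
count-punchIn f zero = refl
count-punchIn {suc n} f (suc v) = begin
  a + count (f ∘ suc) ≡⟨ cong (a +_) (count-punchIn (f ∘ suc) v) ⟩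
  a + (b + c)         ≡⟨ sym (+-assoc a b c) ⟩
  a + b + c           ≡⟨ cong (_+ c) (+-comm a b) ⟩
  b + a + c           ≡⟨ +-assoc b a c ⟩
  b + (a + c)         ∎
  where
  open ≡-Reasoning
  a b c : ℕ
  a = if f zero then 1 else 0
  b = if f (suc v) then 1 else 0
  c = count (f ∘ suc ∘ punchIn v)

count-punchIn-false : ∀ {n} (f : Fin (suc n) → Bool) (v : Fin (suc n)) →
                      f v ≡ false → count f ≡ count (f ∘ punchIn v)
count-punchIn-false f v fv =
  trans (count-punchIn f v) (cong (λ b → (if b then 1 else 0) + count (f ∘ punchIn v)) fv)

count≡0⇒false : ∀ {n} (f : Fin n → Bool) → count f ≡ 0 → ∀ j → f j ≡ false
count≡0⇒false {suc n} f count≡0 j with f j in fj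
... | false = refl
... | true with () ← trans (sym count≡0)
                           (trans (count-punchIn f j) (cong (λ b → (if b then 1 else 0) + count (f ∘ punchIn j)) fj))

adj-irrefl : ∀ {n} (G : Graph n) i → ¬ adj G i i ≡ true
adj-irrefl G i loop with () ← trans (sym loop) (irrefl G i)

data PunchInView {n} (v : Fin (suc n)) : Fin (suc n) → Set where
  pivot   : PunchInView v v
  punched : (i : Fin n) → PunchInView v (punchIn v i)

punchInView : ∀ {n} (v i : Fin (suc n)) → PunchInView v i
punchInView zero zero = pivot
punchInView zero (suc i) = punched i
punchInView {suc n} (suc v) zero = punched zero
punchInView {suc n} (suc v) (suc i) with punchInView v i
... | pivot     = pivot
... | punched j = punched (suc j)

punchInView-pivot : ∀ {n} (v : Fin (suc n)) → punchInView v v ≡ pivot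
punchInView-pivot zero = refl
punchInView-pivot {suc n} (suc v) rewrite punchInView-pivot v = refl

punchInView-punchIn : ∀ {n} (v : Fin (suc n)) (i : Fin n) → punchInView v (punchIn v i) ≡ punched i
punchInView-punchIn zero i = refl
punchInView-punchIn {suc n} (suc v) zero = refl
punchInView-punchIn {suc n} (suc v) (suc i) rewrite punchInView-punchIn v i = refl

BoolRel : ℕ → Set
BoolRel n = Fin n → Fin n → Bool

_⟶⁺_ : ∀ {n} → BoolRel n → Fin n → Fin n → Set
R ⟶⁺ i = TransClosure (λ a b → R a b ≡ true) i

AcyclicRel : ∀ {n} → BoolRel n → Set
AcyclicRel R = ∀ i → ¬ (R ⟶⁺ i) i

⟶⁺-last : ∀ {n} {R : BoolRel n} {i j} → (R ⟶⁺ i) j → ∃ λ k → R k j ≡ true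
⟶⁺-last [ a ]   = _ , a
⟶⁺-last (a ∷ p) = ⟶⁺-last p

acyclic-irrefl : ∀ {n} {R : BoolRel n} → AcyclicRel R → ∀ i → R i i ≡ false
acyclic-irrefl {R = R} acy i with R i i in Rii
... | false = refl
... | true  = ⊥-elim (acy i [ Rii ])

⟶⁺-reverse : ∀ {n} {R : BoolRel n} {i j} → (R ⟶⁺ i) j → (flip R ⟶⁺ j) i
⟶⁺-reverse [ a ]   = [ a ]
⟶⁺-reverse (a ∷ p) = ⟶⁺-reverse p ∷ʳ a

acyclic-flip : ∀ {n} {R : BoolRel n} → AcyclicRel R → AcyclicRel (flip R)
acyclic-flip acy i = acy i ∘ ⟶⁺-reverse

acyclic-comap : ∀ {m n} {R : BoolRel n} (f : Fin m → Fin n) →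
                AcyclicRel R → AcyclicRel (λ i j → R (f i) (f j))
acyclic-comap {R = R} f acy i = acy (f i) ∘ map
  where
  map : ∀ {i j} → ((λ a b → R (f a) (f b)) ⟶⁺ i) j → (R ⟶⁺ f i) (f j)
  map [ a ]   = [ a ]
  map (a ∷ p) = a ∷ map p

-- Contracting vertex 0: a path through 0 becomes a single arc, so acyclicity is preserved.
contract : ∀ {n} → BoolRel (suc (suc n)) → BoolRel (suc n)
contract R i j = R (suc i) (suc j) ∨ (R (suc i) zero ∧ R zero (suc j))

acyclic-contract : ∀ {n} {R : BoolRel (suc (suc n))} → AcyclicRel R → AcyclicRel (contract R)
acyclic-contract {R = R} acy i = acy (suc i) ∘ expand
  where
  expandArc : ∀ {i j} → contract R i j ≡ true → (R ⟶⁺ suc i) (suc j)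
  expandArc {i} {j} c with R (suc i) (suc j) in direct | R (suc i) zero in into0 | R zero (suc j) in out0
  ... | true  | _    | _    = [ direct ]
  ... | false | true | true = into0 ∷ [ out0 ]

  expand : ∀ {i j} → (contract R ⟶⁺ i) j → (R ⟶⁺ suc i) (suc j)
  expand [ c ]   = expandArc c
  expand (c ∷ p) = expandArc c ++ expand p

-- A sink t of the contraction is a sink of R unless t → 0, and then 0 is one.
acyclic⇒sink : ∀ {n} (R : BoolRel (suc n)) → AcyclicRel R → ∃ λ s → ∀ j → R s j ≡ false
acyclic⇒sink {zero} R acy = zero , λ { zero → acyclic-irrefl acy zero }
acyclic⇒sink {suc n} R acy with acyclic⇒sink (contract R) (acyclic-contract acy)
... | t , t-sink with R (suc t) zero in t⟶0
... | false = suc t , λ { zero → t⟶0 ; (suc j) → ∨-conicalˡ _ _ (t-sink j) }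
... | true  = zero  , λ { zero → acyclic-irrefl acy zero ; (suc j) → ∨-conicalʳ _ _ (t-sink j) }

acyclic⇒source : ∀ {n} (R : BoolRel (suc n)) → AcyclicRel R → ∃ λ u → ∀ i → R i u ≡ false
acyclic⇒source R = acyclic⇒sink (flip R) ∘ acyclic-flip

module Extension {n} {G : Graph (suc n)} (v : Fin (suc n)) (O : Orientation (delete G v)) where

  extendDir : ∀ {i j} → PunchInView v i → PunchInView v j → Bool
  extendDir {j = j} pivot _         = adj G v j
  extendDir (punched i) pivot       = false
  extendDir (punched i) (punched j) = dir O i j

  private
    extendDir-edge : ∀ {i j} (vi : PunchInView v i) (vj : PunchInView v j) →
                     extendDir vi vj ≡ true → adj G i j ≡ true
    extendDir-edge pivot       vj          a = a
    extendDir-edge (punched i) (punched j) a = dir-edge O i j a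

    edge-extendDir : ∀ {i j} (vi : PunchInView v i) (vj : PunchInView v j) →
                     adj G i j ≡ true → extendDir vi vj ≡ true ⊎ extendDir vj vi ≡ true
    edge-extendDir pivot       pivot       e = ⊥-elim (adj-irrefl G v e)
    edge-extendDir pivot       (punched j) e = inj₁ e
    edge-extendDir (punched i) pivot       e = inj₂ (trans (Graph.sym G v (punchIn v i)) e)
    edge-extendDir (punched i) (punched j) e = edge-dir O i j e

  extend : Orientation G
  extend = record
    { dir      = λ i j → extendDir (punchInView v i) (punchInView v j)
    ; dir-edge = λ i j → extendDir-edge (punchInView v i) (punchInView v j)
    ; edge-dir = λ i j → edge-extendDir (punchInView v i) (punchInView v j)
    ; antisym  = λ i j → antisym′ (punchInView v i) (punchInView v j)
    }
    where
    antisym′ : ∀ {i j} (vi : PunchInView v i) (vj : PunchInView v j) →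
               extendDir vi vj ≡ true → extendDir vj vi ≡ false
    antisym′ pivot       pivot       a = irrefl G v
    antisym′ pivot       (punched j) a = refl
    antisym′ (punched i) (punched j) a = antisym O i j a

  private
    extendDir-into-pivot : ∀ {i} (vi : PunchInView v i) → extendDir vi pivot ≡ false
    extendDir-into-pivot pivot       = irrefl G v
    extendDir-into-pivot (punched i) = refl

  no-arc-into-pivot : ∀ i → dir extend i v ≡ false
  no-arc-into-pivot i rewrite punchInView-pivot v = extendDir-into-pivot (punchInView v i)

  arc-from-punched : ∀ i y → dir extend (punchIn v i) y ≡ true →
                     ∃ λ j → y ≡ punchIn v j × dir O i j ≡ true
  arc-from-punched i y a rewrite punchInView-punchIn v i = from (punchInView v y) a
    where
    from : ∀ {y} (vy : PunchInView v y) → extendDir (punched i) vy ≡ true →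
           ∃ λ j → y ≡ punchIn v j × dir O i j ≡ true
    from (punched j) a = j , refl , a

  path-from-punched : ∀ {i z} → (dir extend ⟶⁺ punchIn v i) z →
                      ∃ λ k → z ≡ punchIn v k × (dir O ⟶⁺ i) k
  path-from-punched {i} [ a ] with arc-from-punched i _ a
  ... | j , refl , a′ = j , refl , [ a′ ]
  path-from-punched {i} (a ∷ p) with arc-from-punched i _ a
  ... | j , refl , a′ with path-from-punched p
  ...   | k , refl , p′ = k , refl , a′ ∷ p′

  extend-acyclic : Acyclic O → Acyclic extend
  extend-acyclic acy i cycle with punchInView v i
  ... | pivot with k , k⟶v ← ⟶⁺-last cycle with () ← trans (sym k⟶v) (no-arc-into-pivot k)
  extend-acyclic acy _ cycle | punched i with path-from-punched cycle
  ... | k , i≡k , p′ with refl ← punchIn-injective v i k i≡k = acy i p′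

  outdeg-extend-pivot : outdeg extend v ≡ deg G v
  outdeg-extend-pivot =
    count-cong λ j → cong (λ w → extendDir w (punchInView v j)) (punchInView-pivot v)

  outdeg-extend-punchIn : ∀ i → outdeg extend (punchIn v i) ≡ outdeg O i
  outdeg-extend-punchIn i =
    trans (count-punchIn-false (dir extend (punchIn v i)) v (no-arc-into-pivot (punchIn v i)))
          (count-cong λ j → cong₂ extendDir (punchInView-punchIn v i) (punchInView-punchIn v j))

restrict : ∀ {n} {G : Graph (suc n)} (u : Fin (suc n)) → Orientation G → Orientation (delete G u)
restrict u O = record
  { dir      = λ i j → dir O (punchIn u i) (punchIn u j)
  ; dir-edge = λ i j → dir-edge O (punchIn u i) (punchIn u j)
  ; edge-dir = λ i j → edge-dir O (punchIn u i) (punchIn u j)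
  ; antisym  = λ i j → antisym O (punchIn u i) (punchIn u j)
  }

restrict-acyclic : ∀ {n} {G : Graph (suc n)} (u : Fin (suc n)) (O : Orientation G) →
                   Acyclic O → Acyclic (restrict u O)
restrict-acyclic u O = acyclic-comap (punchIn u)

IsSource : ∀ {n} {G : Graph n} → Orientation G → Fin n → Set
IsSource O u = ∀ x → dir O x u ≡ false

outdeg-restrict : ∀ {n} {G : Graph (suc n)} {u} (O : Orientation G) → IsSource O u →
                  ∀ w → outdeg O (punchIn u w) ≡ outdeg (restrict u O) w
outdeg-restrict {u = u} O source w =
  count-punchIn-false (dir O (punchIn u w)) u (source (punchIn u w))

source-dir≡adj : ∀ {n} {G : Graph n} {u} (O : Orientation G) → IsSource O u →
                 ∀ j → dir O u j ≡ adj G u j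
source-dir≡adj {G = G} {u} O source j with adj G u j in u~j
... | true with edge-dir O u j u~j
...   | inj₁ u⟶j = u⟶j
...   | inj₂ j⟶u with () ← trans (sym j⟶u) (source j)
source-dir≡adj {G = G} {u} O source j | false with dir O u j in u⟶j
... | false = refl
... | true with () ← trans (sym (dir-edge O u j u⟶j)) u~j

source-outdeg≡deg : ∀ {n} {G : Graph n} {u} (O : Orientation G) → IsSource O u → outdeg O u ≡ deg G u
source-outdeg≡deg O source = count-cong (source-dir≡adj O source)

SinkOrientation : (ℕ → Set) → ∀ {n} → Graph (suc n) → Set
SinkOrientation A {n} G = Σ (Orientation G) λ O → Acyclic O ×
  Σ (Fin (suc n)) λ s → outdeg O s ≡ 0 × ((v : Fin (suc n)) → v ≢ s → A (outdeg O v))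

OutdegreeOrientation : (ℕ → Set) → ∀ {n} → Graph n → Set
OutdegreeOrientation A {n} G = Σ (Orientation G) λ O → Acyclic O × ((v : Fin n) → A (outdeg O v))

singleton-sinkOrientation : ∀ A (G : Graph 1) → SinkOrientation A G
singleton-sinkOrientation A G =
  O , (λ { zero → λ { [ () ] ; (() ∷ _) } }) , zero , refl , λ { zero 0≢0 → ⊥-elim (0≢0 refl) }
  where
  O : Orientation G
  O = record
    { dir      = λ _ _ → false
    ; dir-edge = λ _ _ ()
    ; edge-dir = λ { zero zero loop → ⊥-elim (adj-irrefl G zero loop) }
    ; antisym  = λ _ _ ()
    }

sinkOrientation-extend : ∀ A {n} {G : Graph (suc (suc n))} (v : Fin (suc (suc n))) →
                         A (deg G v) → SinkOrientation A (delete G v) → SinkOrientation A G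
sinkOrientation-extend A {G = G} v A-deg (O , acy , s , s-sink , A-others) =
  extend , extend-acyclic acy , punchIn v s , trans (outdeg-extend-punchIn s) s-sink , A-outdeg
  where
  open Extension {G = G} v O

  A-outdeg′ : ∀ {w} → PunchInView v w → w ≢ punchIn v s → A (outdeg extend w)
  A-outdeg′ pivot       _   = subst A (sym outdeg-extend-pivot) A-deg
  A-outdeg′ (punched i) w≢s =
    subst A (sym (outdeg-extend-punchIn i)) (A-others i (w≢s ∘ cong (punchIn v)))

  A-outdeg : ∀ w → w ≢ punchIn v s → A (outdeg extend w)
  A-outdeg w = A-outdeg′ (punchInView v w)

sinkOrientation-peel : ∀ A {n} {G : Graph (suc (suc n))} → SinkOrientation A G →
                       ∃ λ u → A (deg G u) × SinkOrientation A (delete G u)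
sinkOrientation-peel A {n} {G} (O , acy , s , s-sink , A-others)
  with t , t-source ← acyclic⇒source _ (restrict-acyclic s O acy) =
  u , subst A (source-outdeg≡deg O u-source) (A-others u u≢s) ,
  restrict u O , restrict-acyclic u O acy , s′ , s′-sink , A-others′
  where
  u : Fin (suc (suc n))
  u = punchIn s t

  u≢s : u ≢ s
  u≢s = punchInᵢ≢i s t

  u-source : IsSource O u
  u-source x with punchInView s x
  ... | pivot     = count≡0⇒false (dir O s) s-sink u
  ... | punched i = t-source i

  s′ : Fin (suc n)
  s′ = punchOut u≢s

  u↑s′≡s : punchIn u s′ ≡ s
  u↑s′≡s = punchIn-punchOut u≢s

  s′-sink : outdeg (restrict u O) s′ ≡ 0
  s′-sink = trans (sym (outdeg-restrict O u-source s′)) (trans (cong (outdeg O) u↑s′≡s) s-sink)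

  A-others′ : ∀ w → w ≢ s′ → A (outdeg (restrict u O) w)
  A-others′ w w≢s′ = subst A (outdeg-restrict O u-source w)
    (A-others (punchIn u w) λ u↑w≡s → w≢s′ (punchIn-injective u w s′ (trans u↑w≡s (sym u↑s′≡s))))

reducible⇒sinkOrientation : ∀ {A n} {G : Graph (suc n)} → Reducible A G → SinkOrientation A G
reducible⇒sinkOrientation {A} (single G)                 = singleton-sinkOrientation A G
reducible⇒sinkOrientation {A} {suc n} (step G v A-deg r) =
  sinkOrientation-extend A v A-deg (reducible⇒sinkOrientation r)

sinkOrientation⇒reducible : ∀ A n (G : Graph (suc n)) → SinkOrientation A G → Reducible A G
sinkOrientation⇒reducible A zero    G _ = single G
sinkOrientation⇒reducible A (suc n) G o with u , A-deg , o′ ← sinkOrientation-peel A o =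
  step G u A-deg (sinkOrientation⇒reducible A n (delete G u) o′)

sinkOrientation⇒outdegreeOrientation : ∀ A {n} {G : Graph (suc n)} →
  A 0 → SinkOrientation A G → OutdegreeOrientation A G
sinkOrientation⇒outdegreeOrientation A A0 (O , acy , s , s-sink , A-others) = O , acy , A-outdeg
  where
  A-outdeg : ∀ v → A (outdeg O v)
  A-outdeg v with v ≟ s
  ... | yes refl = subst A (sym s-sink) A0
  ... | no v≢s   = A-others v v≢s

outdegreeOrientation⇒sinkOrientation : ∀ A {n} {G : Graph (suc n)} →
  OutdegreeOrientation A G → SinkOrientation A G
outdegreeOrientation⇒sinkOrientation A {n} (O , acy , A-outdeg)
  with s , s-sink ← acyclic⇒sink (dir O) acy =
  O , acy , s , trans (count-cong s-sink) (count-false (suc n)) , λ v _ → A-outdeg v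

fact1p3 : (A : ℕ → Set) (n : ℕ) (G : Graph (suc n)) →
            (Reducible A G ⇔
               Σ (Orientation G) (λ O → Acyclic O ×
                 Σ (Fin (suc n)) (λ s → outdeg O s ≡ 0 ×
                   ((v : Fin (suc n)) → v ≢ s → A (outdeg O v)))))
          × (A 0 →
            (Reducible A G ⇔
               Σ (Orientation G) (λ O → Acyclic O ×
                 ((v : Fin (suc n)) → A (outdeg O v)))))
fact1p3 A n G =
  mk⇔ reducible⇒sinkOrientation (sinkOrientation⇒reducible A n G) ,
  λ A0 → mk⇔ (sinkOrientation⇒outdegreeOrientation A A0 ∘ reducible⇒sinkOrientation)
             (sinkOrientation⇒reducible A n G ∘ outdegreeOrientation⇒sinkOrientation A)
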